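{- Let $\mathcal{C}=\mathrm{Geom}\begin{pmatrix}-1&1\\1&-1\end{pmatrix}$ (the "X-class": permutations that can be drawn on the union of the two diagonals of a square). Then for every $n\ge0$, the number of centrosymmetric permutations of size $2n$ in $\mathcal{C}$ is $2^n$.
   Context: A permutation of size $n$ is a bijection of $[n]$. For $\pi$ of size $n$, $\mathrm{rc}(\pi)(i)=n+1-\pi(n+1-i)$; $\pi$ is centrosymmetric if $\mathrm{rc}(\pi)=\pi$. For a $\{0,1,-1\}$-matrix $A$ with $r$ rows and $c$ columns (row 1 at the top), the standard figure is the subset of $[0,c]\times[0,r]$ obtained by placing in the unit square of cell $(i,j)$ (the square $[j-1,j]\times[r-i,r-i+1]$) the diagonal segment of slope $1$ if $A_{i,j}=1$, of slope $-1$ if $A_{i,j}=-1$, and nothing if $A_{i,j}=0$. A set of $n$ points on the figure, no two sharing an $x$- or $y$-coordinate, determines the size-$n$ permutation with the same relative order; $\mathrm{Geom}(A)$ is the set of all permutations so obtained. For the matrix above, the standard figure is the union of the two diagonals of the square $[0,2]^2$.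
   Formalization: The points placed on the standard figure to obtain the permutations of $\mathrm{Geom}(A)$ have rational coordinates. -}

module Defs where

open import Data.Nat as ℕ using (ℕ; zero; suc)
open import Data.Fin as Fin using (Fin; toℕ; opposite)
open import Data.Integer using (+_)
open import Data.Rational using (ℚ; _/_; _+_; _-_; _≤_; _<_)
open import Data.Vec using (Vec; lookup; tabulate; []; _∷_)
open import Data.Product using (_×_; Σ; ∃; ∃₂; _,_; proj₁; proj₂)
open import Relation.Binary.PropositionalEquality using (_≡_)
open import Function.Definitions using (Bijective)
open import Data.Empty using (⊥)

data Entry : Set where
  one minusOne zero : Entry

-- A matrix with r rows and c columns; row index 0 is the top row.
Matrix : ℕ → ℕ → Set
Matrix r c = Fin r → Fin c → Entry

ℕ→ℚ : ℕ → ℚ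
ℕ→ℚ k = + k / 1

Point : Set
Point = ℚ × ℚ

-- Cell (i , j) (0-indexed, i from the top)
-- occupies [j , j+1] × [r-1-i , r-i]; slope 1 segment: y - (r-1-i) = x - j;
-- slope -1 segment: y - (r-1-i) = (j+1) - x.
OnSegment : ∀ {r} → Fin r → ℕ → Entry → Point → Set
OnSegment {r} i j one      (x , y) =
  (ℕ→ℚ j ≤ x) × (x ≤ ℕ→ℚ (suc j)) × (y - ℕ→ℚ (r ℕ.∸ suc (toℕ i)) ≡ x - ℕ→ℚ j)
OnSegment {r} i j minusOne (x , y) =
  (ℕ→ℚ j ≤ x) × (x ≤ ℕ→ℚ (suc j)) × (y - ℕ→ℚ (r ℕ.∸ suc (toℕ i)) ≡ ℕ→ℚ (suc j) - x)
OnSegment i j zero p = ⊥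

OnFigure : ∀ {r c} → Matrix r c → Point → Set
OnFigure {r} {c} A p = ∃₂ λ (i : Fin r) (j : Fin c) → OnSegment i (toℕ j) (A i j) p

-- A permutation of size n, in one-line notation (0-indexed): a vector whose lookup is a bijection.
IsPerm : ∀ {n} → Vec (Fin n) n → Set
IsPerm {n} v = Bijective _≡_ _≡_ (lookup v)

SameOrder : ∀ {n} → Vec (Fin n) n → (Fin n → Point) → Set
SameOrder {n} π p =
  (∀ (a b : Fin n) → toℕ a ℕ.< toℕ b → proj₁ (p a) < proj₁ (p b)) ×
  (∀ (a b : Fin n) → toℕ (lookup π a) ℕ.< toℕ (lookup π b) → proj₂ (p a) < proj₂ (p b))

InGeom : ∀ {r c} → Matrix r c → ∀ {n} → Vec (Fin n) n → Set
InGeom A {n} π = IsPerm π × Σ (Fin n → Point) (λ p → (∀ a → OnFigure A (p a)) × SameOrder π p)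

-- reverse-complement: rc(π)(i) = n+1-π(n+1-i), 0-indexed.
rc : ∀ {n} → Vec (Fin n) n → Vec (Fin n) n
rc π = tabulate (λ i → opposite (lookup π (opposite i)))

Centrosymmetric : ∀ {n} → Vec (Fin n) n → Set
Centrosymmetric π = rc π ≡ π

Xmat : Matrix 2 2
Xmat Fin.zero Fin.zero = minusOne
Xmat Fin.zero (Fin.suc Fin.zero) = one
Xmat (Fin.suc Fin.zero) Fin.zero = one
Xmat (Fin.suc Fin.zero) (Fin.suc Fin.zero) = minusOne

module Submission where

-- Draw a permutation σ of the class on the X, its points listed by increasing abscissa, and let
-- the depth of an index k be min(k, opposite k).  Among the indices of depth ≥ d, the two ends
-- a and b = opposite a bound all abscissae, and whichever end is farther from the centre x = 1
-- is, by the shape of the X, the lowest or the highest of these points.  If every shallower index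
-- is already fixed or sent to its opposite, centrosymmetry makes σ preserve the indices of
-- depth ≥ d, so that end is sent to a or to b, and centrosymmetry transfers this to the other end.
-- Hence a centrosymmetric permutation of the class fixes or swaps each of the n pairs
-- {k, opposite k}, independently; conversely each of these 2ⁿ permutations is drawn by the
-- points ((2i+1)/2n, (2σ(i)+1)/2n).

open import Defs
open import Data.Bool using (Bool; true; false)
open import Data.Empty using (⊥-elim)
open import Data.Fin using (Fin; zero; suc; toℕ; fromℕ<; inject≤; opposite; _≟_)
import Data.Fin.Properties as Fin
open import Data.List using (List; []; _∷_; [_]; _++_; length; map; cartesianProductWith)
import Data.List.Properties as List
open import Data.List.Membership.Propositional using (_∈_)
import Data.List.Membership.Propositional.Properties as Membership
open import Data.List.Relation.Unary.All using ([]; _∷_)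
open import Data.List.Relation.Unary.AllPairs using ([]; _∷_)
open import Data.List.Relation.Unary.Any using (here; there)
open import Data.List.Relation.Unary.Unique.Propositional using (Unique)
import Data.List.Relation.Unary.Unique.Propositional.Properties as Unique
open import Data.Nat using (ℕ; zero; suc; _*_; _^_)
open import Data.Nat.Induction using (<-rec)
open import Data.Product using (Σ; ∃; _×_; _,_; proj₁; proj₂)
open import Data.Sum using (_⊎_; inj₁; inj₂; [_,_]′)
import Data.Sum as Sum
open import Data.Vec using (Vec; []; _∷_; lookup; tabulate)
import Data.Vec.Properties as Vec
open import Function using (_∘_)
open import Function.Bundles using (_⇔_; mk⇔)
open import Relation.Nullary using (yes; no; does)
open import Relation.Binary.PropositionalEquality
  using (_≡_; _≢_; refl; sym; trans; cong; cong₂; subst; subst₂; module ≡-Reasoning)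


module _ where
  open import Data.Rational using (ℚ; 0ℚ; 1ℚ; _+_; _-_; -_; _≤_)
  import Data.Rational.Properties as ℚ
  open import Data.Rational.Solver using (module +-*-Solver)
  open +-*-Solver

  two : ℚ
  two = 1ℚ + 1ℚ

  OnDiagonals : Point → Set
  OnDiagonals (x , y) = y ≡ x ⊎ x + y ≡ two

  private
    -≡-⇒≡ : ∀ x y c → y - c ≡ x - c → y ≡ x
    -≡-⇒≡ x y c eq = begin
      y             ≡⟨ solve 2 (λ y c → y := (y :- c) :+ c) refl y c ⟩
      (y - c) + c   ≡⟨ cong (_+ c) eq ⟩
      (x - c) + c   ≡⟨ solve 2 (λ x c → (x :- c) :+ c := x) refl x c ⟩
      x             ∎
      where open ≡-Reasoning

    -≡-⇒+≡+ : ∀ x y c d → y - c ≡ d - x → x + y ≡ c + d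
    -≡-⇒+≡+ x y c d eq = begin
      x + y               ≡⟨ solve 3 (λ x y c → x :+ y := (y :- c) :+ (c :+ x)) refl x y c ⟩
      (y - c) + (c + x)   ≡⟨ cong (_+ (c + x)) eq ⟩
      (d - x) + (c + x)   ≡⟨ solve 3 (λ x c d → (d :- x) :+ (c :+ x) := c :+ d) refl x c d ⟩
      c + d               ∎
      where open ≡-Reasoning

    +≡+⇒-≡- : ∀ x y c d → x + y ≡ c + d → y - c ≡ d - x
    +≡+⇒-≡- x y c d eq = begin
      y - c               ≡⟨ solve 3 (λ x y c → y :- c := (x :+ y) :- c :- x) refl x y c ⟩
      (x + y) - c - x     ≡⟨ cong (λ z → z - c - x) eq ⟩
      (c + d) - c - x     ≡⟨ solve 3 (λ x c d → (c :+ d) :- c :- x := d :- x) refl x c d ⟩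
      d - x               ∎
      where open ≡-Reasoning

  +-cancelˡ-≤ : ∀ c {u v} → c + u ≤ c + v → u ≤ v
  +-cancelˡ-≤ c {u} {v} le = subst₂ _≤_ (-c+[c+w]≡w u) (-c+[c+w]≡w v) (ℚ.+-monoʳ-≤ (- c) le)
    where
    -c+[c+w]≡w : ∀ w → (- c) + (c + w) ≡ w
    -c+[c+w]≡w w = solve 2 (λ c w → (:- c) :+ (c :+ w) := w) refl c w

  onFigure⇒onDiagonals : ∀ q → OnFigure Xmat q → OnDiagonals q
  onFigure⇒onDiagonals (x , y) (zero     , zero     , _ , _ , eq) = inj₂ (-≡-⇒+≡+ x y 1ℚ 1ℚ eq)
  onFigure⇒onDiagonals (x , y) (zero     , suc zero , _ , _ , eq) = inj₁ (-≡-⇒≡ x y 1ℚ eq)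
  onFigure⇒onDiagonals (x , y) (suc zero , zero     , _ , _ , eq) = inj₁ (-≡-⇒≡ x y 0ℚ eq)
  onFigure⇒onDiagonals (x , y) (suc zero , suc zero , _ , _ , eq) = inj₂ (-≡-⇒+≡+ x y 0ℚ (ℕ→ℚ 2) eq)

  onDiagonals⇒onFigure : ∀ x y → 0ℚ ≤ x → x ≤ two → OnDiagonals (x , y) → OnFigure Xmat (x , y)
  onDiagonals⇒onFigure x y 0≤x x≤2 diag with ℚ.≤-total x 1ℚ | diag
  ... | inj₁ x≤1 | inj₁ eq = suc zero , zero , 0≤x , x≤1 , cong (_- 0ℚ) eq
  ... | inj₂ 1≤x | inj₁ eq = zero , suc zero , 1≤x , x≤2 , cong (_- 1ℚ) eq
  ... | inj₁ x≤1 | inj₂ eq = zero , zero , 0≤x , x≤1 , +≡+⇒-≡- x y 1ℚ 1ℚ eq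
  ... | inj₂ 1≤x | inj₂ eq = suc zero , suc zero , 1≤x , x≤2 , +≡+⇒-≡- x y 0ℚ (ℕ→ℚ 2) eq

  private
    variable
      xa xb xk ya yb yk : ℚ

  mainLeft⇒lowest : xa ≤ xk → xk ≤ xb → OnDiagonals (xk , yk) →
                    xa + xb ≤ two → ya ≡ xa → ya ≤ yk
  mainLeft⇒lowest xa≤xk _ (inj₁ yk≡xk) _ refl = subst (_ ≤_) (sym yk≡xk) xa≤xk
  mainLeft⇒lowest {xa} {xk} {xb} {yk} _ xk≤xb (inj₂ xk+yk≡2) sum≤2 refl =
    +-cancelˡ-≤ xk (begin
      xk + xa   ≡⟨ ℚ.+-comm xk xa ⟩
      xa + xk   ≤⟨ ℚ.+-monoʳ-≤ xa xk≤xb ⟩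
      xa + xb   ≤⟨ sum≤2 ⟩
      two       ≡⟨ xk+yk≡2 ⟨
      xk + yk   ∎)
    where open ℚ.≤-Reasoning

  antiLeft⇒highest : xa ≤ xk → xk ≤ xb → OnDiagonals (xk , yk) →
                     xa + xb ≤ two → xa + ya ≡ two → yk ≤ ya
  antiLeft⇒highest {xa} {xk} {xb} {yk} {ya} _ xk≤xb (inj₁ yk≡xk) sum≤2 xa+ya≡2 =
    +-cancelˡ-≤ xa (begin
      xa + yk   ≡⟨ cong (xa +_) yk≡xk ⟩
      xa + xk   ≤⟨ ℚ.+-monoʳ-≤ xa xk≤xb ⟩
      xa + xb   ≤⟨ sum≤2 ⟩
      two       ≡⟨ xa+ya≡2 ⟨
      xa + ya   ∎)
    where open ℚ.≤-Reasoning
  antiLeft⇒highest {xa} {xk} {xb} {yk} {ya} xa≤xk _ (inj₂ xk+yk≡2) _ xa+ya≡2 =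
    +-cancelˡ-≤ xa (begin
      xa + yk   ≤⟨ ℚ.+-monoˡ-≤ yk xa≤xk ⟩
      xk + yk   ≡⟨ trans xk+yk≡2 (sym xa+ya≡2) ⟩
      xa + ya   ∎)
    where open ℚ.≤-Reasoning

  mainRight⇒highest : xa ≤ xk → xk ≤ xb → OnDiagonals (xk , yk) →
                      two ≤ xa + xb → yb ≡ xb → yk ≤ yb
  mainRight⇒highest _ xk≤xb (inj₁ yk≡xk) _ refl = subst (_≤ _) (sym yk≡xk) xk≤xb
  mainRight⇒highest {xa} {xk} {xb} {yk} xa≤xk _ (inj₂ xk+yk≡2) 2≤sum refl =
    +-cancelˡ-≤ xk (begin
      xk + yk   ≡⟨ xk+yk≡2 ⟩
      two       ≤⟨ 2≤sum ⟩
      xa + xb   ≤⟨ ℚ.+-monoˡ-≤ xb xa≤xk ⟩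
      xk + xb   ∎)
    where open ℚ.≤-Reasoning

  antiRight⇒lowest : xa ≤ xk → xk ≤ xb → OnDiagonals (xk , yk) →
                     two ≤ xa + xb → xb + yb ≡ two → yb ≤ yk
  antiRight⇒lowest {xa} {xk} {xb} {yk} {yb} xa≤xk _ (inj₁ yk≡xk) 2≤sum xb+yb≡2 =
    +-cancelˡ-≤ xb (begin
      xb + yb   ≡⟨ xb+yb≡2 ⟩
      two       ≤⟨ 2≤sum ⟩
      xa + xb   ≤⟨ ℚ.+-monoˡ-≤ xb xa≤xk ⟩
      xk + xb   ≡⟨ ℚ.+-comm xk xb ⟩
      xb + xk   ≡⟨ cong (xb +_) yk≡xk ⟨
      xb + yk   ∎)
    where open ℚ.≤-Reasoning
  antiRight⇒lowest {xa} {xk} {xb} {yk} {yb} _ xk≤xb (inj₂ xk+yk≡2) _ xb+yb≡2 =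
    +-cancelˡ-≤ xb (begin
      xb + yb   ≡⟨ trans xb+yb≡2 (sym xk+yk≡2) ⟩
      xk + yk   ≤⟨ ℚ.+-monoˡ-≤ yk xk≤xb ⟩
      xb + yk   ∎)
    where open ℚ.≤-Reasoning


module _ where
  open import Data.Nat using (_+_; _≤_; _<_; _⊓_; _<?_; s≤s)
  import Data.Nat.Properties as ℕ

  opposite-antitone : ∀ {m} {i j : Fin m} → toℕ i ≤ toℕ j → toℕ (opposite j) ≤ toℕ (opposite i)
  opposite-antitone {m} {i} {j} i≤j =
    subst₂ _≤_ (sym (Fin.opposite-prop j)) (sym (Fin.opposite-prop i)) (ℕ.∸-monoʳ-≤ m (s≤s i≤j))

  ≤-opposite-swap : ∀ {m} {i j : Fin m} → toℕ i ≤ toℕ (opposite j) → toℕ j ≤ toℕ (opposite i)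
  ≤-opposite-swap {j = j} le = subst (λ k → toℕ k ≤ _) (Fin.opposite-involutive j) (opposite-antitone le)

  suc[toℕ+toℕ-opposite]≡n : ∀ {n} (i : Fin n) → suc (toℕ i + toℕ (opposite i)) ≡ n
  suc[toℕ+toℕ-opposite]≡n i =
    trans (cong (suc (toℕ i) +_) (Fin.opposite-prop i)) (ℕ.m+[n∸m]≡n (Fin.toℕ<n i))

  opposite-injective : ∀ {m} {i j : Fin m} → opposite i ≡ opposite j → i ≡ j
  opposite-injective {i = i} {j} eq =
    trans (sym (Fin.opposite-involutive i)) (trans (cong opposite eq) (Fin.opposite-involutive j))

  depth : ∀ {m} → Fin m → ℕ
  depth i = toℕ i ⊓ toℕ (opposite i)

  depth-opposite : ∀ {m} (i : Fin m) → depth (opposite i) ≡ depth i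
  depth-opposite i =
    trans (cong (toℕ (opposite i) ⊓_) (cong toℕ (Fin.opposite-involutive i))) (ℕ.⊓-comm _ _)

  FixesOrMirrors : ∀ {m} → (Fin m → Fin m) → Fin m → Set
  FixesOrMirrors f i = f i ≡ i ⊎ f i ≡ opposite i

  fixesOrMirrors⇒involutive : ∀ {m} {f : Fin m → Fin m} → (∀ i → f (opposite i) ≡ opposite (f i)) →
                              (∀ i → FixesOrMirrors f i) → ∀ i → f (f i) ≡ i
  fixesOrMirrors⇒involutive {f = f} f-opposite fixesOrMirrors i with fixesOrMirrors i
  ... | inj₁ fi≡i  = trans (cong f fi≡i) fi≡i
  ... | inj₂ fi≡i′ = begin
    f (f i)                ≡⟨ cong f fi≡i′ ⟩
    f (opposite i)         ≡⟨ f-opposite i ⟩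
    opposite (f i)         ≡⟨ cong opposite fi≡i′ ⟩
    opposite (opposite i)  ≡⟨ Fin.opposite-involutive i ⟩
    i                      ∎
    where open ≡-Reasoning


centrosymmetric⇒lookup-opposite : ∀ {m} {π : Vec (Fin m) m} → Centrosymmetric π →
                                  ∀ i → lookup π (opposite i) ≡ opposite (lookup π i)
centrosymmetric⇒lookup-opposite {π = π} cs i = begin
  lookup π (opposite i)                              ≡⟨ cong (λ v → lookup v (opposite i)) cs ⟨
  lookup (rc π) (opposite i)                         ≡⟨ Vec.lookup∘tabulate _ (opposite i) ⟩
  opposite (lookup π (opposite (opposite i)))        ≡⟨ cong (opposite ∘ lookup π) (Fin.opposite-involutive i) ⟩
  opposite (lookup π i)                              ∎
  where open ≡-Reasoning


module Rigidity {m} {π : Vec (Fin m) m} (π-perm : IsPerm π) (π-cs : Centrosymmetric π)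
                {p : Fin m → Point} (p-diag : ∀ a → OnDiagonals (p a)) (p-order : SameOrder π p)
                where
  open import Data.Nat using (_≤_; _<_)
  import Data.Nat.Properties as ℕ
  open import Data.Rational using (ℚ; _+_) renaming (_≤_ to _≤ℚ_)
  import Data.Rational.Properties as ℚ

  private
    σ : Fin m → Fin m
    σ = lookup π

    σ-opposite : ∀ i → σ (opposite i) ≡ opposite (σ i)
    σ-opposite = centrosymmetric⇒lookup-opposite π-cs

    σ-injective : ∀ {i j} → σ i ≡ σ j → i ≡ j
    σ-injective = proj₁ π-perm

    σ-surjective : ∀ t → ∃ λ k → σ k ≡ t
    σ-surjective t with proj₂ π-perm t
    ... | k , σ[≡k]≡t = k , σ[≡k]≡t refl

    x y : Fin m → ℚ
    x a = proj₁ (p a)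
    y a = proj₂ (p a)

    x-mono : ∀ {i j} → toℕ i ≤ toℕ j → x i ≤ℚ x j
    x-mono {i} {j} i≤j with ℕ.m≤n⇒m<n∨m≡n i≤j
    ... | inj₁ i<j = ℚ.<⇒≤ (proj₁ p-order i j i<j)
    ... | inj₂ i≡j = ℚ.≤-reflexive (cong x (Fin.toℕ-injective i≡j))

    σ-mono : ∀ {i j} → y i ≤ℚ y j → toℕ (σ i) ≤ toℕ (σ j)
    σ-mono {i} {j} yi≤yj = ℕ.≮⇒≥ λ σj<σi → ℚ.<-irrefl refl (ℚ.<-≤-trans (proj₂ p-order j i σj<σi) yi≤yj)

    fixesOrMirrors-opposite : ∀ k → FixesOrMirrors σ k → FixesOrMirrors σ (opposite k)
    fixesOrMirrors-opposite k = Sum.map step step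
      where
      step : ∀ {j} → σ k ≡ j → σ (opposite k) ≡ opposite j
      step e = trans (σ-opposite k) (cong opposite e)

    fixesOrMirrors-opposite⁻ : ∀ k → FixesOrMirrors σ (opposite k) → FixesOrMirrors σ k
    fixesOrMirrors-opposite⁻ k =
      subst (FixesOrMirrors σ) (Fin.opposite-involutive k) ∘ fixesOrMirrors-opposite (opposite k)

    depth-σ : ∀ {k : Fin m} → FixesOrMirrors σ k → depth (σ k) ≡ depth k
    depth-σ (inj₁ σk≡k)   = cong depth σk≡k
    depth-σ {k} (inj₂ σk≡k′) = trans (cong depth σk≡k′) (depth-opposite k)

    ShallowerThan : ℕ → Set
    ShallowerThan d = ∀ k → depth k < d → FixesOrMirrors σ k

  module Layer {d} (shallower : ShallowerThan d) where

    private
      shallow-σ : ∀ {k : Fin m} → depth k < d → depth (σ k) < d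
      shallow-σ {k} k<d = subst (_< d) (sym (depth-σ (shallower k k<d))) k<d

      shallow-σ⁻ : ∀ {k : Fin m} → depth (σ k) < d → depth k < d
      shallow-σ⁻ {k} σk<d with shallower (σ k) σk<d
      ... | inj₁ σσk≡σk = subst (λ i → depth i < d) (σ-injective σσk≡σk) σk<d
      ... | inj₂ σσk≡σk′ = subst (λ i → depth i < d) (σ-injective σ[σk′]≡σk)
                              (subst (_< d) (sym (depth-opposite (σ k))) σk<d)
        where
        σ[σk′]≡σk : σ (opposite (σ k)) ≡ σ k
        σ[σk′]≡σk = trans (σ-opposite (σ k))
                      (trans (cong opposite σσk≡σk′) (Fin.opposite-involutive (σ k)))

      deep-σ : ∀ {k : Fin m} → d ≤ depth k → d ≤ depth (σ k)
      deep-σ d≤k = ℕ.≮⇒≥ λ σk<d → ℕ.<⇒≱ (shallow-σ⁻ σk<d) d≤k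

      deep-σ⁻ : ∀ {k : Fin m} → d ≤ depth (σ k) → d ≤ depth k
      deep-σ⁻ d≤σk = ℕ.≮⇒≥ λ k<d → ℕ.<⇒≱ (shallow-σ k<d) d≤σk

    module _ {a : Fin m} (a-left : toℕ a ≡ d) (a-deep : d ≤ depth a) where

      private
        b : Fin m
        b = opposite a

        b-deep : d ≤ depth b
        b-deep = subst (d ≤_) (sym (depth-opposite a)) a-deep

        a≤deep : ∀ {k : Fin m} → d ≤ depth k → toℕ a ≤ toℕ k
        a≤deep {k} d≤k = subst (_≤ toℕ k) (sym a-left) (ℕ.m≤n⊓o⇒m≤n _ _ d≤k)

        deep≤b : ∀ {k : Fin m} → d ≤ depth k → toℕ k ≤ toℕ b
        deep≤b {k} d≤k = ≤-opposite-swap (subst (_≤ toℕ (opposite k)) (sym a-left) (ℕ.m≤n⊓o⇒m≤o _ _ d≤k))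

        preimage-deep : ∀ t → d ≤ depth t → ∃ λ k → σ k ≡ t × d ≤ depth k
        preimage-deep t d≤t with σ-surjective t
        ... | k , σk≡t = k , σk≡t , deep-σ⁻ (subst (λ i → d ≤ depth i) (sym σk≡t) d≤t)

        lowest⇒σ≡a : ∀ {e : Fin m} → d ≤ depth e → (∀ k → d ≤ depth k → y e ≤ℚ y k) → σ e ≡ a
        lowest⇒σ≡a {e} d≤e lowest with preimage-deep a a-deep
        ... | k , σk≡a , d≤k = Fin.toℕ-injective (ℕ.≤-antisym
          (subst (λ t → toℕ (σ e) ≤ toℕ t) σk≡a (σ-mono (lowest k d≤k)))
          (a≤deep (deep-σ d≤e)))

        highest⇒σ≡b : ∀ {e : Fin m} → d ≤ depth e → (∀ k → d ≤ depth k → y k ≤ℚ y e) → σ e ≡ b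
        highest⇒σ≡b {e} d≤e highest with preimage-deep b b-deep
        ... | k , σk≡b , d≤k = Fin.toℕ-injective (ℕ.≤-antisym
          (deep≤b (deep-σ d≤e))
          (subst (λ t → toℕ t ≤ toℕ (σ e)) σk≡b (σ-mono (highest k d≤k))))

        module _ {k : Fin m} (d≤k : d ≤ depth k) where
          xa≤xk : x a ≤ℚ x k
          xa≤xk = x-mono (a≤deep d≤k)

          xk≤xb : x k ≤ℚ x b
          xk≤xb = x-mono (deep≤b d≤k)

        leftFarther⇒fixesOrMirrors : x a + x b ≤ℚ two → FixesOrMirrors σ a
        leftFarther⇒fixesOrMirrors sum≤2 with p-diag a
        ... | inj₁ main = inj₁ (lowest⇒σ≡a a-deep λ k d≤k →
                mainLeft⇒lowest (xa≤xk d≤k) (xk≤xb d≤k) (p-diag k) sum≤2 main)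
        ... | inj₂ anti = inj₂ (highest⇒σ≡b a-deep λ k d≤k →
                antiLeft⇒highest (xa≤xk d≤k) (xk≤xb d≤k) (p-diag k) sum≤2 anti)

        rightFarther⇒fixesOrMirrors : two ≤ℚ x a + x b → FixesOrMirrors σ b
        rightFarther⇒fixesOrMirrors 2≤sum with p-diag b
        ... | inj₁ main = inj₁ (highest⇒σ≡b b-deep λ k d≤k →
                mainRight⇒highest (xa≤xk d≤k) (xk≤xb d≤k) (p-diag k) 2≤sum main)
        ... | inj₂ anti = inj₂ (trans (lowest⇒σ≡a b-deep λ k d≤k →
                antiRight⇒lowest (xa≤xk d≤k) (xk≤xb d≤k) (p-diag k) 2≤sum anti)
                (sym (Fin.opposite-involutive a)))

      fixesOrMirrors-leftEnd : FixesOrMirrors σ a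
      fixesOrMirrors-leftEnd =
        [ leftFarther⇒fixesOrMirrors , fixesOrMirrors-opposite⁻ a ∘ rightFarther⇒fixesOrMirrors ]′ (ℚ.≤-total (x a + x b) two)

  fixesOrMirrors : ∀ k → FixesOrMirrors σ k
  fixesOrMirrors k = <-rec (λ d → ∀ k → depth k ≡ d → FixesOrMirrors σ k) atDepth (depth k) k refl
    where
    atDepth : ∀ d → (∀ {d′} → d′ < d → ∀ k → depth k ≡ d′ → FixesOrMirrors σ k) →
              ∀ k → depth k ≡ d → FixesOrMirrors σ k
    atDepth _ ih k refl =
      [ (λ k≡depth → fixesOrMirrors-leftEnd (sym k≡depth) ℕ.≤-refl)
      , (λ k′≡depth → fixesOrMirrors-opposite⁻ k
           (fixesOrMirrors-leftEnd (sym k′≡depth) (ℕ.≤-reflexive (sym (depth-opposite k)))))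
      ]′ (ℕ.⊓-sel (toℕ k) (toℕ (opposite k)))
      where open Layer (λ j j<d → ih j<d j refl)


centrosymmetric-X⇒fixesOrMirrors : ∀ {m} {π : Vec (Fin m) m} → Centrosymmetric π → InGeom Xmat π →
                                   ∀ i → FixesOrMirrors (lookup π) i
centrosymmetric-X⇒fixesOrMirrors cs (perm , p , onFigure , order) =
  Rigidity.fixesOrMirrors perm cs (λ a → onFigure⇒onDiagonals (p a) (onFigure a)) order


module _ where
  open import Data.Nat using (_+_; _<_; z≤n; s≤s)
  import Data.Nat.Properties as ℕ
  open import Data.Nat.Tactic.RingSolver using (solve-∀)
  open import Data.Rational using (ℚ; 0ℚ; 1ℚ; 1/_; NonZero; Positive)
    renaming (_+_ to _+ℚ_; _*_ to _*ℚ_; _≤_ to _≤ℚ_; _<_ to _<ℚ_)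
  import Data.Rational as ℚ using (>-nonZero; positive)
  import Data.Rational.Properties as ℚ

  fromℕ : ℕ → ℚ
  fromℕ zero    = 0ℚ
  fromℕ (suc k) = 1ℚ +ℚ fromℕ k

  fromℕ-+ : ∀ a b → fromℕ (a + b) ≡ fromℕ a +ℚ fromℕ b
  fromℕ-+ zero    b = sym (ℚ.+-identityˡ (fromℕ b))
  fromℕ-+ (suc a) b = trans (cong (1ℚ +ℚ_) (fromℕ-+ a b)) (sym (ℚ.+-assoc 1ℚ (fromℕ a) (fromℕ b)))

  fromℕ-nonNeg : ∀ a → 0ℚ ≤ℚ fromℕ a
  fromℕ-nonNeg zero    = ℚ.≤-refl
  fromℕ-nonNeg (suc a) = ℚ.≤-trans (fromℕ-nonNeg a)
    (subst (_≤ℚ 1ℚ +ℚ fromℕ a) (ℚ.+-identityˡ (fromℕ a)) (ℚ.+-monoˡ-≤ (fromℕ a) (ℚ.<⇒≤ (ℚ.positive⁻¹ 1ℚ))))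

  fromℕ-mono-< : ∀ {a b} → a < b → fromℕ a <ℚ fromℕ b
  fromℕ-mono-< {zero}  {suc b} _         = ℚ.<-≤-trans (ℚ.positive⁻¹ 1ℚ)
    (subst (_≤ℚ 1ℚ +ℚ fromℕ b) (ℚ.+-identityʳ 1ℚ) (ℚ.+-monoʳ-≤ 1ℚ (fromℕ-nonNeg b)))
  fromℕ-mono-< {suc a} {suc b} (s≤s a<b) = ℚ.+-monoʳ-< 1ℚ (fromℕ-mono-< a<b)

  private
    odd+odd : ∀ a b → suc (a + a) + suc (b + b) ≡ suc (a + b) + suc (a + b)
    odd+odd = solve-∀

  module Positions (M : ℕ) where
    private
      m : ℕ
      m = suc M

      0<m : 0ℚ <ℚ fromℕ m
      0<m = fromℕ-mono-< {0} {m} (s≤s z≤n)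

      instance
        m≢0 : NonZero (fromℕ m)
        m≢0 = ℚ.>-nonZero 0<m

      unit : ℚ
      unit = 1/ fromℕ m

      instance
        unit-pos : Positive unit
        unit-pos = ℚ.1/pos⇒pos (fromℕ m) {{ℚ.positive 0<m}}

    position : Fin m → ℚ
    position i = fromℕ (suc (toℕ i + toℕ i)) *ℚ unit

    position-mono : ∀ {i j : Fin m} → toℕ i < toℕ j → position i <ℚ position j
    position-mono i<j = ℚ.*-monoˡ-<-pos unit (fromℕ-mono-< (s≤s (ℕ.+-mono-< i<j i<j)))

    position-nonNeg : ∀ i → 0ℚ ≤ℚ position i
    position-nonNeg i = subst (_≤ℚ position i) (ℚ.*-zeroˡ unit)
      (ℚ.*-monoʳ-≤-nonNeg unit {{ℚ.pos⇒nonNeg unit}} (fromℕ-nonNeg (suc (toℕ i + toℕ i))))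

    position+position-opposite : ∀ i → position i +ℚ position (opposite i) ≡ two
    position+position-opposite i = begin
      fromℕ (odd a) *ℚ unit +ℚ fromℕ (odd b) *ℚ unit  ≡⟨ ℚ.*-distribʳ-+ unit (fromℕ (odd a)) (fromℕ (odd b)) ⟨
      (fromℕ (odd a) +ℚ fromℕ (odd b)) *ℚ unit        ≡⟨ cong (_*ℚ unit) (fromℕ-+ (odd a) (odd b)) ⟨
      fromℕ (odd a + odd b) *ℚ unit                   ≡⟨ cong (λ s → fromℕ s *ℚ unit) (odd+odd a b) ⟩
      fromℕ (suc (a + b) + suc (a + b)) *ℚ unit       ≡⟨ cong (λ s → fromℕ (s + s) *ℚ unit) (suc[toℕ+toℕ-opposite]≡n i) ⟩
      fromℕ (m + m) *ℚ unit                           ≡⟨ cong (_*ℚ unit) (fromℕ-+ m m) ⟩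
      (fromℕ m +ℚ fromℕ m) *ℚ unit                    ≡⟨ ℚ.*-distribʳ-+ unit (fromℕ m) (fromℕ m) ⟩
      fromℕ m *ℚ unit +ℚ fromℕ m *ℚ unit              ≡⟨ cong₂ _+ℚ_ (ℚ.*-inverseʳ (fromℕ m)) (ℚ.*-inverseʳ (fromℕ m)) ⟩
      two                                             ∎
      where
      open ≡-Reasoning
      a = toℕ i
      b = toℕ (opposite i)
      odd : ℕ → ℕ
      odd k = suc (k + k)

    position≤two : ∀ i → position i ≤ℚ two
    position≤two i = subst₂ _≤ℚ_ (ℚ.+-identityʳ (position i)) (position+position-opposite i)
      (ℚ.+-monoʳ-≤ (position i) (position-nonNeg (opposite i)))

  drawing : ∀ {m} (s : Fin m → Fin m) → (∀ i → FixesOrMirrors s i) →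
            Σ (Fin m → Point) (λ p → (∀ a → OnFigure Xmat (p a)) × SameOrder (tabulate s) p)
  drawing {zero}  _ _    = (λ ()) , (λ ()) , (λ ()) , (λ ())
  drawing {suc M} s s-fm = p , onFigure , (λ _ _ → position-mono) , yOrder
    where
    open Positions M

    p : Fin (suc M) → Point
    p i = position i , position (s i)

    onDiagonals : ∀ a → FixesOrMirrors s a → OnDiagonals (p a)
    onDiagonals a (inj₁ sa≡a)  = inj₁ (cong position sa≡a)
    onDiagonals a (inj₂ sa≡a′) =
      inj₂ (trans (cong (λ j → position a +ℚ position j) sa≡a′) (position+position-opposite a))

    onFigure : ∀ a → OnFigure Xmat (p a)
    onFigure a = onDiagonals⇒onFigure _ _ (position-nonNeg a) (position≤two a) (onDiagonals a (s-fm a))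

    yOrder : ∀ a b → toℕ (lookup (tabulate s) a) < toℕ (lookup (tabulate s) b) → position (s a) <ℚ position (s b)
    yOrder a b lt = position-mono (subst₂ (λ i j → toℕ i < toℕ j) (Vec.lookup∘tabulate s a) (Vec.lookup∘tabulate s b) lt)


module Halves (n : ℕ) where
  open import Data.Nat using (_+_; _≤_; _<_)
  import Data.Nat.Properties as ℕ

  private
    high+high≢ : ∀ {a b} → n ≤ a → n ≤ b → suc (a + b) ≢ n + n
    high+high≢ {a = a} {b} n≤a n≤b eq =
      ℕ.<-irrefl refl (subst (_≤ a + b) (sym eq) (ℕ.+-mono-≤ n≤a n≤b))

    low+low≢ : ∀ {a b} → a < n → b < n → suc (a + b) ≢ n + n
    low+low≢ {a} {b} a<n b<n eq =
      ℕ.<-irrefl refl (subst (λ s → suc s ≤ n + n) eq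
        (subst (_≤ n + n) (ℕ.+-suc (suc a) b) (ℕ.+-mono-≤ a<n b<n)))

    toℕ+toℕ-opposite : (i : Fin (2 * n)) → suc (toℕ i + toℕ (opposite i)) ≡ n + n
    toℕ+toℕ-opposite i = trans (suc[toℕ+toℕ-opposite]≡n i) (cong (n +_) (ℕ.+-identityʳ n))

  depth<half : (i : Fin (2 * n)) → depth i < n
  depth<half i = ℕ.≰⇒> λ n≤d →
    high+high≢ (ℕ.≤-trans n≤d (ℕ.m⊓n≤m _ _)) (ℕ.≤-trans n≤d (ℕ.m⊓n≤n _ _)) (toℕ+toℕ-opposite i)

  toℕ<half⇒depth≡toℕ : (i : Fin (2 * n)) → toℕ i < n → depth i ≡ toℕ i
  toℕ<half⇒depth≡toℕ i i<n = ℕ.m≤n⇒m⊓n≡m (ℕ.≮⇒≥ λ opp<i →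
    low+low≢ i<n (ℕ.<-trans opp<i i<n) (toℕ+toℕ-opposite i))

  opposite-≢ : (i : Fin (2 * n)) → i ≢ opposite i
  opposite-≢ i i≡i′ = high+high≢ n≤i n≤i sum
    where
    sum : suc (toℕ i + toℕ i) ≡ n + n
    sum = subst (λ j → suc (toℕ i + toℕ j) ≡ n + n) (sym i≡i′) (toℕ+toℕ-opposite i)
    n≤i : n ≤ toℕ i
    n≤i = ℕ.≮⇒≥ λ i<n → low+low≢ i<n i<n sum

  layer : Fin (2 * n) → Fin n
  layer i = fromℕ< (depth<half i)

  firstHalf : Fin n → Fin (2 * n)
  firstHalf j = inject≤ j (ℕ.m≤n*m n 2)

  layer-opposite : (i : Fin (2 * n)) → layer (opposite i) ≡ layer i
  layer-opposite i = Fin.fromℕ<-cong _ _ (depth-opposite i) (depth<half (opposite i)) (depth<half i)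

  layer-firstHalf : (j : Fin n) → layer (firstHalf j) ≡ j
  layer-firstHalf j = Fin.toℕ-injective (begin
    toℕ (layer (firstHalf j))   ≡⟨ Fin.toℕ-fromℕ< (depth<half (firstHalf j)) ⟩
    depth (firstHalf j)         ≡⟨ toℕ<half⇒depth≡toℕ (firstHalf j) (subst (_< n) (sym toℕ-firstHalf) (Fin.toℕ<n j)) ⟩
    toℕ (firstHalf j)           ≡⟨ toℕ-firstHalf ⟩
    toℕ j                       ∎)
    where
    open ≡-Reasoning
    toℕ-firstHalf : toℕ (firstHalf j) ≡ toℕ j
    toℕ-firstHalf = Fin.toℕ-inject≤ j (ℕ.m≤n*m n 2)

  firstHalf-layer : (i : Fin (2 * n)) → FixesOrMirrors (firstHalf ∘ layer) i
  firstHalf-layer i = Sum.map (Fin.toℕ-injective ∘ trans toℕ-firstHalf-layer)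
                              (Fin.toℕ-injective ∘ trans toℕ-firstHalf-layer)
                              (ℕ.⊓-sel (toℕ i) (toℕ (opposite i)))
    where
    toℕ-firstHalf-layer : toℕ (firstHalf (layer i)) ≡ depth i
    toℕ-firstHalf-layer = trans (Fin.toℕ-inject≤ (layer i) (ℕ.m≤n*m n 2)) (Fin.toℕ-fromℕ< (depth<half i))


flipIf : ∀ {m} → Bool → Fin m → Fin m
flipIf true  i = opposite i
flipIf false i = i

flipIf-opposite : ∀ {m} c (i : Fin m) → flipIf c (opposite i) ≡ opposite (flipIf c i)
flipIf-opposite true  i = refl
flipIf-opposite false i = refl

flipIf-fixesOrMirrors : ∀ {m} c (i : Fin m) → FixesOrMirrors (flipIf c) i
flipIf-fixesOrMirrors true  i = inj₂ refl
flipIf-fixesOrMirrors false i = inj₁ refl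

flipIf-injectiveˡ : ∀ {m} {i : Fin m} → i ≢ opposite i → ∀ c c′ → flipIf c i ≡ flipIf c′ i → c ≡ c′
flipIf-injectiveˡ i≢i′ true  true  _  = refl
flipIf-injectiveˡ i≢i′ true  false eq = ⊥-elim (i≢i′ (sym eq))
flipIf-injectiveˡ i≢i′ false true  eq = ⊥-elim (i≢i′ eq)
flipIf-injectiveˡ i≢i′ false false _  = refl


module BitEncoding (n : ℕ) where
  open Halves n

  layered : Vec Bool n → Fin (2 * n) → Fin (2 * n)
  layered bits i = flipIf (lookup bits (layer i)) i

  layered-opposite : (bits : Vec Bool n) (i : Fin (2 * n)) → layered bits (opposite i) ≡ opposite (layered bits i)
  layered-opposite bits i =
    trans (cong (λ j → flipIf (lookup bits j) (opposite i)) (layer-opposite i)) (flipIf-opposite (lookup bits (layer i)) i)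

  layered-involutive : (bits : Vec Bool n) (i : Fin (2 * n)) → layered bits (layered bits i) ≡ i
  layered-involutive bits =
    fixesOrMirrors⇒involutive (layered-opposite bits) (λ i → flipIf-fixesOrMirrors (lookup bits (layer i)) i)

  fromBits : Vec Bool n → Vec (Fin (2 * n)) (2 * n)
  fromBits bits = tabulate (layered bits)

  fromBits-isPerm : (bits : Vec Bool n) → IsPerm (fromBits bits)
  fromBits-isPerm bits = injective , surjective
    where
    lookup-fromBits : ∀ i → lookup (fromBits bits) i ≡ layered bits i
    lookup-fromBits = Vec.lookup∘tabulate (layered bits)

    injective : ∀ {i j} → lookup (fromBits bits) i ≡ lookup (fromBits bits) j → i ≡ j
    injective {i} {j} eq = begin
      i                               ≡⟨ layered-involutive bits i ⟨
      layered bits (layered bits i)   ≡⟨ cong (layered bits) (trans (sym (lookup-fromBits i)) (trans eq (lookup-fromBits j))) ⟩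
      layered bits (layered bits j)   ≡⟨ layered-involutive bits j ⟩
      j                               ∎
      where open ≡-Reasoning

    surjective : ∀ t → ∃ λ i → ∀ {k} → k ≡ i → lookup (fromBits bits) k ≡ t
    surjective t = layered bits t , λ { refl → trans (lookup-fromBits _) (layered-involutive bits t) }

  fromBits-centrosymmetric : (bits : Vec Bool n) → Centrosymmetric (fromBits bits)
  fromBits-centrosymmetric bits = Vec.tabulate-cong λ i → begin
    opposite (lookup (fromBits bits) (opposite i))   ≡⟨ cong opposite (Vec.lookup∘tabulate (layered bits) (opposite i)) ⟩
    opposite (layered bits (opposite i))             ≡⟨ cong opposite (layered-opposite bits i) ⟩
    opposite (opposite (layered bits i))             ≡⟨ Fin.opposite-involutive _ ⟩
    layered bits i                                   ∎
    where open ≡-Reasoning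

  fromBits-inGeom : (bits : Vec Bool n) → InGeom Xmat (fromBits bits)
  fromBits-inGeom bits = fromBits-isPerm bits , drawing (layered bits) (λ i → flipIf-fixesOrMirrors (lookup bits (layer i)) i)

  fromBits-injective : ∀ {bits bits′ : Vec Bool n} → fromBits bits ≡ fromBits bits′ → bits ≡ bits′
  fromBits-injective {bits = bits} {bits′} eq = begin
    bits                         ≡⟨ Vec.tabulate∘lookup bits ⟨
    tabulate (lookup bits)       ≡⟨ Vec.tabulate-cong same-bit ⟩
    tabulate (lookup bits′)      ≡⟨ Vec.tabulate∘lookup bits′ ⟩
    bits′                        ∎
    where
    open ≡-Reasoning
    same-bit : ∀ j → lookup bits j ≡ lookup bits′ j
    same-bit j = flipIf-injectiveˡ (opposite-≢ (firstHalf j)) _ _ (begin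
      flipIf (lookup bits j) (firstHalf j)                         ≡⟨ cong (λ k → flipIf (lookup bits k) (firstHalf j)) (layer-firstHalf j) ⟨
      layered bits (firstHalf j)                                   ≡⟨ Vec.lookup∘tabulate (layered bits) _ ⟨
      lookup (fromBits bits) (firstHalf j)                         ≡⟨ cong (λ v → lookup v (firstHalf j)) eq ⟩
      lookup (fromBits bits′) (firstHalf j)                        ≡⟨ Vec.lookup∘tabulate (layered bits′) _ ⟩
      layered bits′ (firstHalf j)                                  ≡⟨ cong (λ k → flipIf (lookup bits′ k) (firstHalf j)) (layer-firstHalf j) ⟩
      flipIf (lookup bits′ j) (firstHalf j)                        ∎)

  toBits : Vec (Fin (2 * n)) (2 * n) → Vec Bool n
  toBits π = tabulate λ j → does (lookup π (firstHalf j) ≟ opposite (firstHalf j))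

  fromBits-toBits : ∀ {π : Vec (Fin (2 * n)) (2 * n)} → Centrosymmetric π →
                    (∀ i → FixesOrMirrors (lookup π) i) → fromBits (toBits π) ≡ π
  fromBits-toBits {π} cs fixesOrMirrors = trans (Vec.tabulate-cong agree) (Vec.tabulate∘lookup π)
    where
    bit : Fin (2 * n) → Bool
    bit j = does (lookup π j ≟ opposite j)

    flipIf-bit : ∀ j → flipIf (bit j) j ≡ lookup π j
    flipIf-bit j with lookup π j ≟ opposite j | fixesOrMirrors j
    ... | yes πj≡j′ | _           = sym πj≡j′
    ... | no  _     | inj₁ πj≡j   = sym πj≡j
    ... | no  πj≢j′ | inj₂ πj≡j′  = ⊥-elim (πj≢j′ πj≡j′)

    agree : ∀ i → layered (toBits π) i ≡ lookup π i
    agree i = trans (cong (λ c → flipIf c i) (Vec.lookup∘tabulate _ (layer i))) (from-representative (firstHalf-layer i))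
      where
      from-representative : FixesOrMirrors (firstHalf ∘ layer) i → flipIf (bit (firstHalf (layer i))) i ≡ lookup π i
      from-representative (inj₁ j≡i)  = subst (λ j → flipIf (bit j) i ≡ lookup π i) (sym j≡i) (flipIf-bit i)
      from-representative (inj₂ j≡i′) = opposite-injective (begin
        opposite (flipIf c i)      ≡⟨ flipIf-opposite c i ⟨
        flipIf c (opposite i)      ≡⟨ cong (flipIf c) j≡i′ ⟨
        flipIf c j                 ≡⟨ flipIf-bit j ⟩
        lookup π j                 ≡⟨ cong (lookup π) j≡i′ ⟩
        lookup π (opposite i)      ≡⟨ centrosymmetric⇒lookup-opposite cs i ⟩
        opposite (lookup π i)      ∎)
        where
        open ≡-Reasoning
        j = firstHalf (layer i)
        c = bit j

module _ where
  open import Data.Nat using (_+_)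
  import Data.Nat.Properties as ℕ

  bitVectors : (n : ℕ) → List (Vec Bool n)
  bitVectors zero    = [ [] ]
  bitVectors (suc n) = cartesianProductWith _∷_ (true ∷ false ∷ []) (bitVectors n)

  length-bitVectors : ∀ n → length (bitVectors n) ≡ 2 ^ n
  length-bitVectors zero    = refl
  length-bitVectors (suc n) = begin
    length (map (true ∷_) L ++ map (false ∷_) L ++ [])          ≡⟨ List.length-++ (map (true ∷_) L) ⟩
    length (map (true ∷_) L) + length (map (false ∷_) L ++ [])  ≡⟨ cong₂ _+_ (List.length-map _ L) length-second ⟩
    length L + length L                                         ≡⟨ cong (λ k → k + k) (length-bitVectors n) ⟩
    2 ^ n + 2 ^ n                                               ≡⟨ cong (2 ^ n +_) (ℕ.+-identityʳ (2 ^ n)) ⟨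
    2 ^ suc n                                                   ∎
    where
    open ≡-Reasoning
    L = bitVectors n
    length-second : length (map (false ∷_) L ++ []) ≡ length L
    length-second = trans (cong length (List.++-identityʳ (map (false ∷_) L))) (List.length-map _ L)

  bitVectors-unique : ∀ n → Unique (bitVectors n)
  bitVectors-unique zero    = [] ∷ []
  bitVectors-unique (suc n) = Unique.cartesianProductWith⁺ _∷_ Vec.∷-injective
    (((λ ()) ∷ []) ∷ [] ∷ []) (bitVectors-unique n)

  bitVectors-complete : ∀ {n} (bits : Vec Bool n) → bits ∈ bitVectors n
  bitVectors-complete []          = here refl
  bitVectors-complete (c ∷ bits)  = Membership.∈-cartesianProductWith⁺ _∷_ (bool∈ c) (bitVectors-complete bits)
    where
    bool∈ : ∀ c → c ∈ true ∷ false ∷ []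
    bool∈ true  = here refl
    bool∈ false = there (here refl)


proposition3p2 : (n : ℕ) →
    Σ (List (Vec (Fin (2 * n)) (2 * n))) (λ L →
      Unique L ×
      (∀ π → (π ∈ L) ⇔ (IsPerm π × Centrosymmetric π × InGeom Xmat π)) ×
      length L ≡ 2 ^ n)
proposition3p2 n =
  map fromBits (bitVectors n) ,
  Unique.map⁺ fromBits-injective (bitVectors-unique n) ,
  (λ π → mk⇔ listed⇒class (class⇒listed π)) ,
  trans (List.length-map fromBits (bitVectors n)) (length-bitVectors n)
  where
  open BitEncoding n

  listed⇒class : ∀ {π} → π ∈ map fromBits (bitVectors n) → IsPerm π × Centrosymmetric π × InGeom Xmat π
  listed⇒class π∈ with Membership.∈-map⁻ fromBits π∈
  ... | bits , _ , refl = fromBits-isPerm bits , fromBits-centrosymmetric bits , fromBits-inGeom bits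

  class⇒listed : ∀ π → IsPerm π × Centrosymmetric π × InGeom Xmat π → π ∈ map fromBits (bitVectors n)
  class⇒listed π (_ , cs , geom) =
    subst (_∈ map fromBits (bitVectors n)) (fromBits-toBits cs (centrosymmetric-X⇒fixesOrMirrors cs geom))
      (Membership.∈-map⁺ fromBits (bitVectors-complete (toBits π)))
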